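{- Let $\phi$ be a 3-CNF formula with clauses $C_1,\dots,C_m$ over boolean variables $x_1,\dots,x_n$, with $n$ even, and let $G(\phi)$ be the graph constructed as follows. Take vertices $X_i$ and $\overline{X_i}$ for $1\le i\le n$; make $X_i$ adjacent to $\overline{X_i}$, and make each of $X_i,\overline{X_i}$ adjacent to each of $X_{i-1},\overline{X_{i-1}},X_{i+1},\overline{X_{i+1}}$ whenever these exist. Add a path $V_1V_2\cdots V_n$ with $V_n$ adjacent to $X_1$ and $\overline{X_1}$, and a path $V_{n+1}V_{n+2}\cdots V_{2n}$ with $V_{n+1}$ adjacent to $X_n$ and $\overline{X_n}$. For every clause $C_j$ add a vertex $C_j$, and for every literal occurring in $C_j$ join $C_j$ to the literal's vertex ($X_i$ for the literal $x_i$, $\overline{X_i}$ for the literal $\overline{x_i}$) by a path of length $\frac{n}{2}+1$ whose internal vertices are new. Then $G(\phi)$ is $(\frac{n}{2}+1)$-laminar if and only if $\phi$ is satisfiable.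
   Context: $d(x,y)$ is the shortest-path distance, $ecc(x)=\max_{y\ne x} d(x,y)$, $diam(G)=\max_x ecc(x)$. A path is diametral if its length equals $diam(G)$. A path $\mu$ is $k$-dominating if every vertex is at distance at most $k$ from some vertex of $\mu$. A graph is $k$-laminar if it has a $k$-dominating diametral path. -}

module Defs where

open import Data.Nat using (ℕ; zero; suc; _≤_; _<_; ⌊_/2⌋)
open import Data.Fin using (Fin; toℕ)
open import Data.Bool using (Bool; true; false; T)
open import Data.Product using (Σ; ∃; ∃-syntax; _×_; _,_; proj₁; proj₂)
open import Data.Sum using (_⊎_)
open import Data.Vec using (Vec)
open import Data.Vec.Relation.Unary.Any using (Any; any?)
open import Data.Product.Properties using (≡-dec)
import Data.Fin as Fin
import Data.Bool as Bool
open import Relation.Nullary using (does)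
open import Relation.Binary.PropositionalEquality using (_≡_)

record Graph : Set₁ where
  field
    Vtx : Set
    Adj : Vtx → Vtx → Set

module _ (G : Graph) where
  open Graph G

  data Walk : Vtx → Vtx → ℕ → Set where
    nil  : ∀ {u} → Walk u u 0
    cons : ∀ {u v w k} → Adj u v → Walk v w k → Walk u w (suc k)

  data OnWalk (z : Vtx) : ∀ {u v k} → Walk u v k → Set where
    here  : ∀ {v k} (w : Walk z v k) → OnWalk z w
    there : ∀ {u v w k} (a : Adj u v) (p : Walk v w k) → OnWalk z p → OnWalk z (cons a p)

  Dist : Vtx → Vtx → ℕ → Set
  Dist x y k = Walk x y k × (∀ k' → Walk x y k' → k ≤ k')

  IsDiam : ℕ → Set
  IsDiam D = (∀ x y → ∃[ k ] (Dist x y k × k ≤ D))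
           × (∃[ x ] ∃[ y ] Dist x y D)

  Dominating : ℕ → ∀ {u v l} → Walk u v l → Set
  Dominating k p = ∀ z → ∃[ y ] (OnWalk y p × ∃[ d ] (Dist z y d × d ≤ k))

  -- diametral path: a shortest path between its ends whose length is diam(G)
  -- k-laminar: there is a k-dominating diametral path
  Laminar : ℕ → Set
  Laminar k = ∃[ D ] (IsDiam D × ∃[ x ] ∃[ y ] Σ (Walk x y D) λ p →
                (Dist x y D × Dominating k p))

-- literal (i , true) is x_i ; (i , false) is ¬x_i
Literal : ℕ → Set
Literal n = Fin n × Bool

Clause : ℕ → Set
Clause n = Vec (Literal n) 3

CNF3 : ℕ → ℕ → Set
CNF3 n m = Fin m → Clause n

occurs : ∀ {n} → Literal n → Clause n → Bool
occurs l c = does (any? (λ l' → ≡-dec Fin._≟_ Bool._≟_ l l') c)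

Satisfiable : ∀ {n m} → CNF3 n m → Set
Satisfiable {n} φ = Σ (Fin n → Bool) λ a → (∀ j → Any (λ l → a (proj₁ l) ≡ proj₂ l) (φ j))

module Construction {n m : ℕ} (φ : CNF3 n m) where

  h : ℕ
  h = ⌊ n /2⌋

  data Vtx : Set where
    X  : Fin n → Bool → Vtx            -- X i true = X_i ; X i false = X̄_i
    VL : Fin n → Vtx                    -- VL t = V_{t+1}      (V_1 … V_n)
    VR : Fin n → Vtx                    -- VR t = V_{n+t+1}    (V_{n+1} … V_{2n})
    C  : Fin m → Vtx
    -- internal vertex number t+1 (t < n/2) of the path from C_j to literal l
    P  : (j : Fin m) (l : Literal n) → T (occurs l (φ j)) → Fin h → Vtx

  litV : Literal n → Vtx
  litV (i , b) = X i b

  data Edge : Vtx → Vtx → Set where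
    xx     : ∀ i → Edge (X i true) (X i false)
    ladder : ∀ i i' b b' → toℕ i' ≡ suc (toℕ i) → Edge (X i b) (X i' b')
    vl     : ∀ t t' → toℕ t' ≡ suc (toℕ t) → Edge (VL t) (VL t')
    vlx    : ∀ t i b → suc (toℕ t) ≡ n → toℕ i ≡ 0 → Edge (VL t) (X i b)
    vr     : ∀ t t' → toℕ t' ≡ suc (toℕ t) → Edge (VR t) (VR t')
    vrx    : ∀ t i b → toℕ t ≡ 0 → suc (toℕ i) ≡ n → Edge (VR t) (X i b)
    cp     : ∀ j l o t → toℕ t ≡ 0 → Edge (C j) (P j l o t)
    pp     : ∀ j l o t t' → toℕ t' ≡ suc (toℕ t) → Edge (P j l o t) (P j l o t')
    px     : ∀ j l o t → suc (toℕ t) ≡ h → Edge (P j l o t) (litV l)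

  G : Graph
  G = record { Vtx = Vtx ; Adj = λ u v → Edge u v ⊎ Edge v u }

module Submission where

-- Distances are bounded from below by 1-Lipschitz potentials and from above by
-- explicit walks.
-- Module Reduction (n = k + 2, h = n/2) then proves both directions:
--  * satisfying assignment a ⇒ the spine V₁…Vₙ X₁ᵃ⁽¹⁾…Xₙᵃ⁽ⁿ⁾ Vₙ₊₁…V₂ₙ is a
--    diametral path of length D = 3n − 1 that (h + 1)-dominates G(φ);
--  * a dominating diametral path p is never shorter than D, never contains both
--    X_i and X̄_i (a vertex of p near a tail end sees both at one distance,
--    against parity along p) and meets a literal vertex of every clause (it
--    crosses level h + 1 of the clause potential); read off p, a satisfies φ.

open import Defs
open import Data.Nat using (ℕ; zero; suc; _+_; _*_; _∸_; _≤_; _<_; z≤n; s≤s; s≤s⁻¹; ∣_-_∣; ⌊_/2⌋; _⊓_)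
open import Data.Nat.Properties
open import Data.Nat.Divisibility using (_∣_; divides)
open import Data.Nat.Induction using (<-rec)
open import Data.Fin as Fin using (Fin; toℕ; fromℕ<)
open import Data.Fin.Properties using (toℕ<n; toℕ-injective; toℕ-fromℕ<; toℕ-fromℕ; any?)
open import Data.Bool as Bool using (Bool; true; false; T)
open import Data.Bool.Properties using (T-irrelevant)
open import Data.Vec using (_∷_)
open import Data.Vec.Relation.Unary.Any as Any using (Any; here; there)
open import Data.Vec.Membership.Propositional using (find)
import Data.Sum.Properties as Sum
import Data.Product.Properties as Product
open import Data.Product using (Σ; ∃; ∃-syntax; _×_; _,_; proj₁; proj₂)
open import Data.Sum using (_⊎_; inj₁; inj₂; swap; map; map₁)
open import Data.Empty using (⊥; ⊥-elim)
open import Function.Bundles using (_⇔_; mk⇔)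
open import Relation.Nullary using (¬_; Dec; yes; no; does)
open import Relation.Nullary.Decidable using (map′; _×-dec_; _⊎-dec_)
open import Relation.Binary.Definitions using (DecidableEquality; tri<; tri≈; tri>)
open import Relation.Binary.PropositionalEquality

Searchable : Set → Set₁
Searchable A = ∀ {Q : A → Set} → (∀ a → Dec (Q a)) → Dec (∃ Q)

search-Bool : Searchable Bool
search-Bool Q? = map′ (λ { (inj₁ q) → true , q ; (inj₂ q) → false , q })
                      (λ { (true , q) → inj₁ q ; (false , q) → inj₂ q })
                      (Q? true ⊎-dec Q? false)

search-Fin : ∀ {N} → Searchable (Fin N)
search-Fin = any?

search-T : ∀ b → Searchable (T b)
search-T true  Q? = map′ (λ q → _ , q) proj₂ (Q? _)
search-T false Q? = no λ ()

search-⊎ : ∀ {A B} → Searchable A → Searchable B → Searchable (A ⊎ B)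
search-⊎ sA sB Q? = map′ (λ { (inj₁ (a , q)) → inj₁ a , q ; (inj₂ (b , q)) → inj₂ b , q })
                         (λ { (inj₁ a , q) → inj₁ (a , q) ; (inj₂ b , q) → inj₂ (b , q) })
                         (sA (λ a → Q? (inj₁ a)) ⊎-dec sB (λ b → Q? (inj₂ b)))

search-Σ : ∀ {A} {B : A → Set} → Searchable A → (∀ a → Searchable (B a)) → Searchable (Σ A B)
search-Σ sA sB Q? = map′ (λ (a , b , q) → (a , b) , q) (λ ((a , b) , q) → a , b , q)
                         (sA (λ a → sB a (λ b → Q? (a , b))))

search-onto : ∀ {A B} (f : A → B) (g : B → A) → (∀ b → f (g b) ≡ b) →
              Searchable A → Searchable B
search-onto f g fg sA {Q} Q? = map′ (λ (a , q) → f a , q) (λ (b , q) → g b , subst Q (sym (fg b)) q)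
                                    (sA (λ a → Q? (f a)))

distance-parity : ∀ w a → ∣ w - a ∣ ≢ ∣ w - suc a ∣
distance-parity zero    a       ()
distance-parity (suc w) zero    e = 1+n≢n (trans e (∣-∣-identityʳ w))
distance-parity (suc w) (suc a) e = distance-parity w a e

gap-one : ∀ a b → ∣ a - b ∣ ≡ 1 → b ≡ suc a ⊎ a ≡ suc b
gap-one zero    b       e = inj₁ e
gap-one (suc a) zero    e = inj₂ e
gap-one (suc a) (suc b) e = map (cong suc) (cong suc) (gap-one a b e)

not-equidistant : ∀ w a b → ∣ a - b ∣ ≡ 1 → ∣ w - a ∣ ≢ ∣ w - b ∣
not-equidistant w a b e with gap-one a b e
... | inj₁ refl = distance-parity w a
... | inj₂ refl = λ q → distance-parity w b (sym q)

occurs-sound : ∀ {n} {l : Literal n} (c : Clause n) → T (occurs l c) → Any (l ≡_) c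
occurs-sound {l = l} c o with Any.any? (λ l' → Product.≡-dec Fin._≟_ Bool._≟_ l l') c
... | yes mem = mem
... | no  _   = ⊥-elim o

occurs-complete : ∀ {n} {l : Literal n} (c : Clause n) → Any (l ≡_) c → T (occurs l c)
occurs-complete {l = l} c mem with Any.any? (λ l' → Product.≡-dec Fin._≟_ Bool._≟_ l l') c
... | yes _  = _
... | no  ¬m = ¬m mem

module Walks (G : Graph) (adj-sym : ∀ {u v} → Graph.Adj G u v → Graph.Adj G v u) where
  open Graph G

  infixr 5 _++w_
  _++w_ : ∀ {x y z k l} → Walk G x y k → Walk G y z l → Walk G x z (k + l)
  nil      ++w q = q
  cons a p ++w q = cons a (p ++w q)

  snoc : ∀ {x y z k} → Walk G x y k → Adj y z → Walk G x z (suc k)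
  snoc nil        a = cons a nil
  snoc (cons b p) a = cons b (snoc p a)

  reverse : ∀ {x y k} → Walk G x y k → Walk G y x k
  reverse nil        = nil
  reverse (cons a p) = snoc (reverse p) (adj-sym a)

  on-++ˡ : ∀ {x y z w k l} (p : Walk G x y k) (q : Walk G y z l) → OnWalk G w p → OnWalk G w (p ++w q)
  on-++ˡ p          q (here _)          = here _
  on-++ˡ (cons a p) q (there .a .p o) = there a _ (on-++ˡ p q o)

  on-++ʳ : ∀ {x y z w k l} (p : Walk G x y k) (q : Walk G y z l) → OnWalk G w q → OnWalk G w (p ++w q)
  on-++ʳ nil        q o = o
  on-++ʳ (cons a p) q o = there a _ (on-++ʳ p q o)

  record Split {x y k} (p : Walk G x y k) (z : Vtx) : Set where
    field
      k₁ k₂   : ℕ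
      prefix  : Walk G x z k₁
      suffix  : Walk G z y k₂
      lengths : k₁ + k₂ ≡ k
      on-prefix : ∀ {w} → OnWalk G w prefix → OnWalk G w p
      on-suffix : ∀ {w} → OnWalk G w suffix → OnWalk G w p
      on-parts  : ∀ {w} → OnWalk G w p → OnWalk G w prefix ⊎ OnWalk G w suffix

  split : ∀ {x y k z} (p : Walk G x y k) → OnWalk G z p → Split p z
  split p (here _) = record
    { k₁ = 0 ; k₂ = _ ; prefix = nil ; suffix = p ; lengths = refl
    ; on-prefix = λ { (here _) → here _ } ; on-suffix = λ o → o ; on-parts = inj₂ }
  split (cons a p) (there .a .p o) = record
    { k₁ = suc S.k₁ ; k₂ = S.k₂ ; prefix = cons a S.prefix ; suffix = S.suffix
    ; lengths = cong suc S.lengths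
    ; on-prefix = λ { (here _) → here _ ; (there _ _ o') → there a p (S.on-prefix o') }
    ; on-suffix = λ o' → there a p (S.on-suffix o')
    ; on-parts  = λ { (here _) → inj₁ (here _)
                    ; (there _ _ o') → map₁ (there a S.prefix) (S.on-parts o') } }
    where module S = Split (split p o)

  NoShorter : Vtx → Vtx → ℕ → Set
  NoShorter x y k = ∀ r → Walk G x y r → k ≤ r

  dist-unique : ∀ {x y k l} → Dist G x y k → Walk G x y l → NoShorter x y l → k ≡ l
  dist-unique (wk , k-min) wl l-min = ≤-antisym (k-min _ wl) (l-min _ wk)

  middle-shortest : ∀ {x u v y k₁ k₂ k₃ D} → NoShorter x y D → k₁ + (k₂ + k₃) ≡ D →
                    Walk G x u k₁ → Walk G v y k₃ → NoShorter u v k₂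
  middle-shortest {k₁ = k₁} {k₂} {k₃} short eq a c r w =
    +-cancelʳ-≤ k₃ k₂ r (+-cancelˡ-≤ k₁ _ _ (≤-trans (≤-reflexive eq) (short _ (a ++w w ++w c))))

  module Lipschitz (f : Vtx → ℕ) (lip : ∀ {u v} → Adj u v → f v ≤ suc (f u)) where

    walk-bound : ∀ {x y k} → Walk G x y k → f y ≤ f x + k
    walk-bound {x} nil = ≤-reflexive (sym (+-identityʳ (f x)))
    walk-bound {x} {k = suc k} (cons a p) = begin
      _              ≤⟨ walk-bound p ⟩
      _ + k          ≤⟨ +-monoˡ-≤ k (lip a) ⟩
      suc (f x) + k  ≡⟨ sym (+-suc (f x) k) ⟩
      f x + suc k    ∎
      where open ≤-Reasoning

    tight : ∀ {x y k} → Walk G x y k → f x + k ≡ f y → Dist G x y k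
    tight {x} w eq = w , λ r w' → +-cancelˡ-≤ (f x) _ _ (≤-trans (≤-reflexive eq) (walk-bound w'))

    Between : ℕ → ℕ → ℕ → Set
    Between c a b = (a ≤ c × c ≤ b) ⊎ (b ≤ c × c ≤ a)

    intermediate : ∀ {x y k} (p : Walk G x y k) c → Between c (f x) (f y) →
                   ∃[ z ] (OnWalk G z p × f z ≡ c)
    intermediate {x} nil c (inj₁ (a , b)) = x , here nil , ≤-antisym a b
    intermediate {x} nil c (inj₂ (a , b)) = x , here nil , ≤-antisym a b
    intermediate {x} {y} (cons a p) c between with f x ≟ c
    ... | yes e = x , here _ , e
    ... | no ne =
      let (z , o , e) = intermediate p c (step between) in z , there a p o , e
      where
        -- c differs from f x, so it still lies between the next value and f y
        step : Between c (f x) (f y) → Between c (f _) (f y)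
        step (inj₁ (u , w)) = inj₁ (≤-trans (lip a) (≤∧≢⇒< u ne) , w)
        step (inj₂ (u , w)) = inj₂ (u , s≤s⁻¹ (≤-trans (≤∧≢⇒< w (≢-sym ne)) (lip (adj-sym a))))

  module Geodesic {x y D} (p : Walk G x y D) (p-short : NoShorter x y D) where

    position : ∀ {u} → OnWalk G u p → ∃[ k ] Dist G x u k
    position o = S.k₁ , S.prefix , middle-shortest p-short S.lengths nil S.suffix
      where module S = Split (split p o)

    position-gap : ∀ {u v ku kv d} → OnWalk G u p → OnWalk G v p →
                   Dist G x u ku → Dist G x v kv → Dist G u v d → ∣ ku - kv ∣ ≡ d
    position-gap {ku = ku} {kv} {d} ou ov du dv duv with Split.on-parts (split p ou) ov
    ... | inj₂ v-after = begin
        ∣ ku - kv ∣               ≡⟨ cong₂ ∣_-_∣ ku≡ kv≡ ⟩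
        ∣ S.k₁ - S.k₁ + T.k₁ ∣    ≡⟨ ∣m-m+n∣≡n S.k₁ T.k₁ ⟩
        T.k₁                      ≡⟨ sym d≡ ⟩
        d                         ∎
      where
        open ≡-Reasoning
        module S = Split (split p ou)
        module T = Split (split S.suffix v-after)
        lengths : S.k₁ + (T.k₁ + T.k₂) ≡ D
        lengths = trans (cong (S.k₁ +_) T.lengths) S.lengths
        ku≡ : ku ≡ S.k₁
        ku≡ = dist-unique du S.prefix (middle-shortest p-short S.lengths nil S.suffix)
        kv≡ : kv ≡ S.k₁ + T.k₁
        kv≡ = dist-unique dv (S.prefix ++w T.prefix)
                (middle-shortest p-short (trans (+-assoc S.k₁ T.k₁ T.k₂) lengths) nil T.suffix)
        d≡ : d ≡ T.k₁
        d≡ = dist-unique duv T.prefix (middle-shortest p-short lengths S.prefix T.suffix)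
    ... | inj₁ v-before = begin
        ∣ ku - kv ∣               ≡⟨ cong₂ ∣_-_∣ ku≡ kv≡ ⟩
        ∣ T.k₁ + T.k₂ - T.k₁ ∣    ≡⟨ ∣-∣-comm (T.k₁ + T.k₂) T.k₁ ⟩
        ∣ T.k₁ - T.k₁ + T.k₂ ∣    ≡⟨ ∣m-m+n∣≡n T.k₁ T.k₂ ⟩
        T.k₂                      ≡⟨ sym d≡ ⟩
        d                         ∎
      where
        open ≡-Reasoning
        module S = Split (split p ou)
        module T = Split (split S.prefix v-before)
        lengths : T.k₁ + (T.k₂ + S.k₂) ≡ D
        lengths = trans (sym (+-assoc T.k₁ T.k₂ S.k₂)) (trans (cong (_+ S.k₂) T.lengths) S.lengths)
        ku≡ : ku ≡ T.k₁ + T.k₂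
        ku≡ = trans (dist-unique du S.prefix (middle-shortest p-short S.lengths nil S.suffix))
                    (sym T.lengths)
        kv≡ : kv ≡ T.k₁
        kv≡ = dist-unique dv T.prefix (middle-shortest p-short lengths nil (T.suffix ++w S.suffix))
        d≡ : d ≡ T.k₂
        d≡ = dist-unique duv (reverse T.suffix)
               (λ r w → middle-shortest p-short lengths T.prefix S.suffix r (reverse w))

  module Decidable (_≟V_ : DecidableEquality Vtx) (adj? : ∀ u v → Dec (Adj u v))
                   (search : Searchable Vtx) where

    walk? : ∀ k x y → Dec (Walk G x y k)
    walk? zero x y with x ≟V y
    ... | yes refl = yes nil
    ... | no ne    = no λ { nil → ne refl }
    walk? (suc k) x y = map′ (λ (v , a , w) → cons a w) (λ { (cons a w) → _ , a , w })
                             (search (λ v → adj? x v ×-dec walk? k v y))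

    shortest : ∀ {x y k} → Walk G x y k → ∃[ d ] (Dist G x y d × d ≤ k)
    shortest {x} {y} {k} = <-rec Shortens step k
      where
        Shortens : ℕ → Set
        Shortens k = Walk G x y k → ∃[ d ] (Dist G x y d × d ≤ k)
        step : ∀ k → (∀ {j} → j < k → Shortens j) → Shortens k
        step k rec w with any? (λ (j : Fin k) → walk? (toℕ j) x y)
        ... | yes (j , w') = let (d , dist , d≤j) = rec (toℕ<n j) w'
                             in d , dist , ≤-trans d≤j (<⇒≤ (toℕ<n j))
        ... | no none = k , (w , minimal) , ≤-refl
          where
            minimal : NoShorter x y k
            minimal r w' with k ≤? r
            ... | yes k≤r = k≤r
            ... | no  k≰r = ⊥-elim (none (fromℕ< (≰⇒> k≰r) ,
                              subst (Walk G x y) (sym (toℕ-fromℕ< (≰⇒> k≰r))) w'))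

    on? : ∀ z {x y k} (p : Walk G x y k) → Dec (OnWalk G z p)
    on? z {x} nil with z ≟V x
    ... | yes refl = yes (here nil)
    ... | no ne    = no λ { (here _) → ne refl }
    on? z {x} (cons a q) with z ≟V x | on? z q
    ... | yes refl | _     = yes (here _)
    ... | no ne    | yes o = yes (there a q o)
    ... | no ne    | no o  = no λ { (here _) → ne refl ; (there _ _ o') → o o' }

next : ∀ {N} (t t' : Fin N) (d : ℕ) → toℕ t' ≡ toℕ t + suc d →
       Σ (Fin N) λ s → toℕ s ≡ suc (toℕ t) × toℕ t' ≡ toℕ s + d
next t t' d e = fromℕ< lt , toℕ-fromℕ< lt ,
                trans e (trans (+-suc (toℕ t) d) (cong (_+ d) (sym (toℕ-fromℕ< lt))))
  where
    lt : suc (toℕ t) < _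
    lt = ≤-trans (s≤s (≤-trans (s≤s (m≤m+n (toℕ t) d)) (≤-reflexive (sym (trans e (+-suc (toℕ t) d))))))
                 (toℕ<n t')

Near : ℕ → ℕ → Set
Near a b = b ≤ suc a × a ≤ suc b

near-refl : ∀ a → Near a a
near-refl a = n≤1+n a , n≤1+n a

near-sym : ∀ {a b} → Near a b → Near b a
near-sym (x , y) = y , x

near-suc : ∀ {a b} → b ≡ suc a → Near a b
near-suc refl = ≤-refl , ≤-trans (n≤1+n _) (n≤1+n _)

near-+ : ∀ c {a b} → Near a b → Near (c + a) (c + b)
near-+ c (x , y) = ≤-trans (+-monoʳ-≤ c x) (≤-reflexive (+-suc c _)) ,
                   ≤-trans (+-monoʳ-≤ c y) (≤-reflexive (+-suc c _))

near-⊓ : ∀ {a a' b b'} → Near a a' → Near b b' → Near (a ⊓ b) (a' ⊓ b')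
near-⊓ (x , y) (z , w) = ⊓-mono-≤ x z , ⊓-mono-≤ y w

near-∸ : ∀ a t → Near (a ∸ t) (a ∸ suc t)
near-∸ a t = ≤-trans (∸-monoʳ-≤ a (n≤1+n t)) (n≤1+n _) , decrease a t
  where
    decrease : ∀ a t → a ∸ t ≤ suc (a ∸ suc t)
    decrease zero    t       = ≤-trans (≤-reflexive (0∸n≡0 t)) z≤n
    decrease (suc a) zero    = ≤-refl
    decrease (suc a) (suc t) = decrease a t

-- The reduction for an even number n = k + 2 of variables; h = n/2 = ⌊ k /2⌋ + 1.
module Reduction (k m : ℕ) (φ : CNF3 (suc (suc k)) m)
                 (n≡h+h : suc (suc k) ≡ ⌊ suc (suc k) /2⌋ + ⌊ suc (suc k) /2⌋) where
  open Construction φ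
  open Walks G swap
  open Graph G using (Adj)

  n' n h' : ℕ
  n' = suc k
  n  = suc n'
  h' = ⌊ k /2⌋

  first last : Fin n
  first = Fin.zero
  last  = Fin.fromℕ n'

  toℕ-last : toℕ last ≡ n'
  toℕ-last = toℕ-fromℕ n'

  index≤ : (t : Fin n) → toℕ t ≤ n'
  index≤ t = s≤s⁻¹ (toℕ<n t)

  h<n : h < n
  h<n = ≤-trans (+-monoˡ-≤ h (s≤s z≤n)) (≤-reflexive (sym n≡h+h))

  module Chain {N} (F : Fin N → Vtx) (step : ∀ t t' → toℕ t' ≡ suc (toℕ t) → Adj (F t) (F t')) where

    along : (t t' : Fin N) (d : ℕ) → toℕ t' ≡ toℕ t + d → Walk G (F t) (F t') d
    along t t' zero e with toℕ-injective (trans e (+-identityʳ (toℕ t)))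
    ... | refl = nil
    along t t' (suc d) e = let (s , s≡ , e') = next t t' d e in cons (step t s s≡) (along s t' d e')

    on-along : (t t' : Fin N) (d : ℕ) (e : toℕ t' ≡ toℕ t + d) (s : Fin N) →
               toℕ t ≤ toℕ s → toℕ s ≤ toℕ t' → OnWalk G (F s) (along t t' d e)
    on-along t t' zero e s t≤s s≤t' with toℕ-injective (trans e (+-identityʳ (toℕ t)))
    ... | refl with toℕ-injective (≤-antisym s≤t' t≤s)
    ...   | refl = here _
    on-along t t' (suc d) e s t≤s s≤t' with toℕ s ≟ toℕ t
    ... | yes s≡t with toℕ-injective s≡t
    ...   | refl = here _
    on-along t t' (suc d) e s t≤s s≤t' | no s≢t = let (u , u≡ , e') = next t t' d e in
      there _ _ (on-along u t' d e' s (≤-trans (≤-reflexive u≡) (≤∧≢⇒< t≤s (≢-sym s≢t))) s≤t')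

  module LeftPath  = Chain VL (λ t t' e → inj₁ (vl t t' e))
  module RightPath = Chain VR (λ t t' e → inj₁ (vr t t' e))
  module Row (a : Fin n → Bool) = Chain (λ t → X t (a t)) (λ t t' e → inj₁ (ladder t t' _ _ e))

  ladder-walk : (i i' : Fin n) (d : ℕ) (b b' : Bool) → toℕ i' ≡ toℕ i + suc d → Walk G (X i b) (X i' b') (suc d)
  ladder-walk i i' d b b' e = let (s , s≡ , e') = next i i' d e in
    cons (inj₁ (ladder i s b b' s≡)) (Row.along (λ _ → b') s i' d e')

  flip-walk : ∀ i b b' → b ≢ b' → Walk G (X i b) (X i b') 1
  flip-walk i true  true  ne = ⊥-elim (ne refl)
  flip-walk i true  false ne = cons (inj₁ (xx i)) nil
  flip-walk i false true  ne = cons (inj₂ (xx i)) nil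
  flip-walk i false false ne = ⊥-elim (ne refl)

  module Gadget (j : Fin m) (l : Literal n) (o : T (occurs l (φ j))) where
    open Chain (P j l o) (λ t t' e → inj₁ (pp j l o t t' e))

    to-literal : (t : Fin h) → Walk G (P j l o t) (litV l) (suc (h' ∸ toℕ t))
    to-literal t = snoc (along t (Fin.fromℕ h') (h' ∸ toℕ t) e)
                        (inj₁ (px j l o (Fin.fromℕ h') (cong suc (toℕ-fromℕ h'))))
      where
        e : toℕ (Fin.fromℕ h') ≡ toℕ t + (h' ∸ toℕ t)
        e = trans (toℕ-fromℕ h') (sym (m+[n∸m]≡n (s≤s⁻¹ (toℕ<n t))))

    to-literal-length : (t : Fin h) → suc (h' ∸ toℕ t) ≤ h
    to-literal-length t = s≤s (m∸n≤m h' (toℕ t))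

    clause-to-literal : Walk G (C j) (litV l) (suc h)
    clause-to-literal = cons (inj₁ (cp j l o Fin.zero refl)) (to-literal Fin.zero)

    to-clause : (t : Fin h) → Walk G (P j l o t) (C j) (suc (toℕ t))
    to-clause t = reverse (cons (inj₁ (cp j l o Fin.zero refl)) (along Fin.zero t (toℕ t) refl))

  -- A potential determined by values on the spine: n + ℓ i on the literal row,
  -- vL and vR on the two tails, n + h on clause vertices, and on a gadget the
  -- smaller of the values propagated from its clause end and its literal end.
  module SpinePotential (ℓ vL vR : Fin n → ℕ)
    (ℓ-near  : ∀ i i' → toℕ i' ≡ suc (toℕ i) → Near (ℓ i) (ℓ i'))
    (ℓ<n     : ∀ i → suc (ℓ i) ≤ h + h)
    (vL-near : ∀ t t' → toℕ t' ≡ suc (toℕ t) → Near (vL t) (vL t'))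
    (vL-X    : ∀ t i → suc (toℕ t) ≡ n → toℕ i ≡ 0 → Near (vL t) (n + ℓ i))
    (vR-near : ∀ t t' → toℕ t' ≡ suc (toℕ t) → Near (vR t) (vR t'))
    (vR-X    : ∀ t i → toℕ t ≡ 0 → suc (toℕ i) ≡ n → Near (vR t) (n + ℓ i)) where

    gadget : Literal n → Fin h → ℕ
    gadget l t = suc (h + toℕ t) ⊓ (ℓ (proj₁ l) + (h ∸ toℕ t))

    f : Vtx → ℕ
    f (X i b)     = n + ℓ i
    f (VL t)      = vL t
    f (VR t)      = vR t
    f (C j)       = n + h
    f (P j l o t) = n + gadget l t

    edge-near : ∀ {u v} → Edge u v → Near (f u) (f v)
    edge-near (xx i)                 = near-refl _
    edge-near (ladder i i' b b' e)   = near-+ n (ℓ-near i i' e)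
    edge-near (vl t t' e)            = vL-near t t' e
    edge-near (vlx t i b e₁ e₂)      = vL-X t i e₁ e₂
    edge-near (vr t t' e)            = vR-near t t' e
    edge-near (vrx t i b e₁ e₂)      = vR-X t i e₁ e₂
    edge-near (cp j l o t e)         = near-+ n (upper , lower)
      where
        upper : gadget l t ≤ suc h
        upper = ≤-trans (m⊓n≤m _ _) (s≤s (≤-reflexive (trans (cong (h +_) e) (+-identityʳ h))))
        lower : h ≤ suc (gadget l t)
        lower = ≤-trans (⊓-glb (≤-trans (m≤m+n h (toℕ t)) (n≤1+n _))
                               (≤-trans (≤-reflexive (cong (h ∸_) (sym e))) (m≤n+m _ _)))
                        (n≤1+n _)
    edge-near (pp j l o t t' e) rewrite e =
      near-+ n (near-⊓ (near-suc (cong suc (+-suc h (toℕ t))))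
                       (near-+ (ℓ (proj₁ l)) (near-∸ h (toℕ t))))
    edge-near (px j l o t e)         = near-+ n (lower , upper)
      where
        last-step : h ∸ toℕ t ≡ 1
        last-step = trans (cong (_∸ toℕ t) (sym e)) (m+n∸n≡m 1 (toℕ t))
        lower : ℓ (proj₁ l) ≤ suc (gadget l t)
        lower = ≤-trans (⊓-glb (≤-trans (≤-trans (n≤1+n _) (ℓ<n (proj₁ l)))
                                        (≤-reflexive (trans (cong (h +_) (sym e)) (+-suc h (toℕ t)))))
                               (m≤m+n _ _))
                        (n≤1+n _)
        upper : gadget l t ≤ suc (ℓ (proj₁ l))
        upper = ≤-trans (m⊓n≤n _ _) (≤-reflexive (trans (cong (ℓ (proj₁ l) +_) last-step) (+-comm _ 1)))

    lip : ∀ {u v} → Adj u v → f v ≤ suc (f u)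
    lip (inj₁ e) = proj₁ (edge-near e)
    lip (inj₂ e) = proj₂ (edge-near e)

    open Lipschitz f lip public

    gadget-high : ∀ j l o t → suc n ≤ f (P j l o t)
    gadget-high j l o t = ≤-trans (≤-reflexive (+-comm 1 n))
                            (+-monoʳ-≤ n (⊓-glb (s≤s z≤n) (≤-trans (m<n⇒0<n∸m (toℕ<n t)) (m≤n+m _ _))))

  left-junction : ∀ (t i : Fin n) → toℕ t ≡ 0 → suc (toℕ i) ≡ n → Near (n + n + toℕ t) (n + toℕ i)
  left-junction t i e₁ e₂ = near-sym (near-suc (begin
    n + n + toℕ t     ≡⟨ cong (n + n +_) e₁ ⟩
    n + n + 0         ≡⟨ +-identityʳ (n + n) ⟩
    n + suc n'        ≡⟨ cong (n +_) (sym e₂) ⟩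
    n + suc (toℕ i)   ≡⟨ +-suc n (toℕ i) ⟩
    suc (n + toℕ i)   ∎))
    where open ≡-Reasoning

  right-junctionˡ : ∀ (t i : Fin n) → suc (toℕ t) ≡ n → toℕ i ≡ 0 →
                    Near (n + n + (n' ∸ toℕ t)) (n + (n' ∸ toℕ i))
  right-junctionˡ t i e₁ e₂ = near-sym (near-suc (begin
    n + n + (n' ∸ toℕ t)    ≡⟨ cong (λ z → n + n + (n' ∸ z)) (suc-injective e₁) ⟩
    n + n + (n' ∸ n')       ≡⟨ cong (n + n +_) (n∸n≡0 n') ⟩
    n + n + 0               ≡⟨ +-identityʳ (n + n) ⟩
    n + suc n'              ≡⟨ +-suc n n' ⟩
    suc (n + n')            ≡⟨ cong (λ z → suc (n + (n' ∸ z))) (sym e₂) ⟩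
    suc (n + (n' ∸ toℕ i))  ∎))
    where open ≡-Reasoning

  right-junctionʳ : ∀ (t i : Fin n) → toℕ t ≡ 0 → suc (toℕ i) ≡ n → Near (n' ∸ toℕ t) (n + (n' ∸ toℕ i))
  right-junctionʳ t i e₁ e₂ = near-suc (begin
    n + (n' ∸ toℕ i)   ≡⟨ cong (λ z → n + (n' ∸ z)) (suc-injective e₂) ⟩
    n + (n' ∸ n')      ≡⟨ cong (n +_) (n∸n≡0 n') ⟩
    n + 0              ≡⟨ +-identityʳ n ⟩
    suc n'             ≡⟨ cong (λ z → suc (n' ∸ z)) (sym e₁) ⟩
    suc (n' ∸ toℕ t)   ∎)
    where open ≡-Reasoning

  countdown-near : ∀ (i i' : Fin n) → toℕ i' ≡ suc (toℕ i) → Near (n' ∸ toℕ i) (n' ∸ toℕ i')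
  countdown-near i i' e = subst (λ z → Near (n' ∸ toℕ i) (n' ∸ z)) (sym e) (near-∸ n' (toℕ i))

  -- the potential growing from the far end V₁ of the left tail
  module LeftPotential = SpinePotential toℕ toℕ (λ t → n + n + toℕ t)
    (λ i i' e → near-suc e)
    (λ i → ≤-trans (toℕ<n i) (≤-reflexive n≡h+h))
    (λ t t' e → near-suc e)
    (λ t i e₁ e₂ → near-suc (trans (cong (n +_) e₂) (trans (+-identityʳ n) (sym e₁))))
    (λ t t' e → near-+ (n + n) (near-suc e))
    left-junction

  -- its mirror image, growing from the far end V₂ₙ of the right tail
  module RightPotential = SpinePotential (λ i → n' ∸ toℕ i) (λ t → n + n + (n' ∸ toℕ t)) (λ t → n' ∸ toℕ t)
    countdown-near
    (λ i → ≤-trans (s≤s (m∸n≤m n' (toℕ i))) (≤-reflexive n≡h+h))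
    (λ t t' e → near-+ (n + n) (countdown-near t t' e))
    right-junctionˡ
    countdown-near
    right-junctionʳ

  -- For a clause C_j: 0 at C_j, t + 1 along its gadgets, h + 1 at the vertices
  -- of its literals and h + 2 everywhere else.  It is 1-Lipschitz, so it bounds
  -- the distance to C_j from below.
  module ClausePotential (j : Fin m) where

    far : ℕ
    far = suc (suc h)

    level : Bool → ℕ
    level true  = suc h
    level false = far

    ψ : Vtx → ℕ
    ψ (X i b) = level (occurs (i , b) (φ j))
    ψ (VL _)  = far
    ψ (VR _)  = far
    ψ (C j') with j' Fin.≟ j
    ... | yes _ = 0
    ... | no  _ = far
    ψ (P j' l o t) with j' Fin.≟ j
    ... | yes _ = suc (toℕ t)
    ... | no  _ = far

    level-near : ∀ b b' → Near (level b) (level b')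
    level-near true  true  = near-refl _
    level-near true  false = near-suc refl
    level-near false true  = near-sym (near-suc refl)
    level-near false false = near-refl _

    far-near : ∀ b → Near far (level b)
    far-near true  = near-sym (near-suc refl)
    far-near false = near-refl _

    gadget-end : ∀ {t} → suc t ≡ h → ∀ b → T b → Near (suc t) (level b)
    gadget-end e true _ = near-suc (cong suc (sym e))

    edge-near : ∀ {u v} → Edge u v → Near (ψ u) (ψ v)
    edge-near (xx i)               = level-near _ _
    edge-near (ladder i i' b b' e) = level-near _ _
    edge-near (vl t t' e)          = near-refl _
    edge-near (vlx t i b e₁ e₂)    = far-near _
    edge-near (vr t t' e)          = near-refl _
    edge-near (vrx t i b e₁ e₂)    = far-near _
    edge-near (cp j' l o t e) with j' Fin.≟ j
    ... | yes _ = near-suc (cong suc e)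
    ... | no  _ = near-refl _
    edge-near (pp j' l o t t' e) with j' Fin.≟ j
    ... | yes _ = near-suc (cong suc e)
    ... | no  _ = near-refl _
    edge-near (px j' (i , b) o t e) with j' Fin.≟ j
    ... | yes refl = gadget-end e (occurs (i , b) (φ j)) o
    ... | no  _    = far-near _

    lip : ∀ {u v} → Adj u v → ψ v ≤ suc (ψ u)
    lip (inj₁ e) = proj₁ (edge-near e)
    lip (inj₂ e) = proj₂ (edge-near e)

    open Lipschitz ψ lip public

    ψ-clause : ψ (C j) ≡ 0
    ψ-clause with j Fin.≟ j
    ... | yes _ = refl
    ... | no ne = ⊥-elim (ne refl)

    far≰ : ¬ (far ≤ suc h)
    far≰ = 1+n≰n

    reach-clause : ∀ z → ψ z ≤ suc h → ∃[ L ] (Walk G z (C j) L × L ≤ suc h)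
    reach-clause (X i b) le with occurs (i , b) (φ j) in occ
    ... | true  = _ , reverse (Gadget.clause-to-literal j (i , b) (subst T (sym occ) _)) , ≤-refl
    ... | false = ⊥-elim (far≰ le)
    reach-clause (VL t) le = ⊥-elim (far≰ le)
    reach-clause (VR t) le = ⊥-elim (far≰ le)
    reach-clause (C j') le with j' Fin.≟ j
    ... | yes refl = 0 , nil , z≤n
    ... | no  _    = ⊥-elim (far≰ le)
    reach-clause (P j' l o t) le with j' Fin.≟ j
    ... | yes refl = _ , Gadget.to-clause j l o t , ≤-trans (toℕ<n t) (n≤1+n h)
    ... | no  _    = ⊥-elim (far≰ le)

    level-literal : ∀ z → ψ z ≡ suc h → ∃[ i ] ∃[ b ] (z ≡ X i b × T (occurs (i , b) (φ j)))
    level-literal (X i b) e with occurs (i , b) (φ j) in occ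
    ... | true  = i , b , refl , subst T (sym occ) _
    ... | false = ⊥-elim (1+n≢n (suc-injective e))
    level-literal (VL t) e = ⊥-elim (1+n≢n (suc-injective e))
    level-literal (VR t) e = ⊥-elim (1+n≢n (suc-injective e))
    level-literal (C j') e with j' Fin.≟ j
    ... | yes _ = ⊥-elim (0≢1+n e)
    ... | no  _ = ⊥-elim (1+n≢n (suc-injective e))
    level-literal (P j' l o t) e with j' Fin.≟ j
    ... | yes _ = ⊥-elim (<-irrefl (suc-injective e) (toℕ<n t))
    ... | no  _ = ⊥-elim (1+n≢n (suc-injective e))

  Code : Set
  Code = Literal n ⊎ Fin n ⊎ Fin n ⊎ Fin m ⊎
         Σ (Fin m × Literal n) λ jl → T (occurs (proj₂ jl) (φ (proj₁ jl))) × Fin h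

  encode : Vtx → Code
  encode (X i b)     = inj₁ (i , b)
  encode (VL t)      = inj₂ (inj₁ t)
  encode (VR t)      = inj₂ (inj₂ (inj₁ t))
  encode (C j)       = inj₂ (inj₂ (inj₂ (inj₁ j)))
  encode (P j l o t) = inj₂ (inj₂ (inj₂ (inj₂ ((j , l) , o , t))))

  decode : Code → Vtx
  decode (inj₁ (i , b))                          = X i b
  decode (inj₂ (inj₁ t))                         = VL t
  decode (inj₂ (inj₂ (inj₁ t)))                  = VR t
  decode (inj₂ (inj₂ (inj₂ (inj₁ j))))           = C j
  decode (inj₂ (inj₂ (inj₂ (inj₂ ((j , l) , o , t))))) = P j l o t

  decode-encode : ∀ v → decode (encode v) ≡ v
  decode-encode (X i b)     = refl
  decode-encode (VL t)      = refl
  decode-encode (VR t)      = refl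
  decode-encode (C j)       = refl
  decode-encode (P j l o t) = refl

  _≟L_ : DecidableEquality (Literal n)
  _≟L_ = Product.≡-dec Fin._≟_ Bool._≟_

  _≟C_ : DecidableEquality Code
  _≟C_ = Sum.≡-dec _≟L_ (Sum.≡-dec Fin._≟_ (Sum.≡-dec Fin._≟_ (Sum.≡-dec Fin._≟_
           (Product.≡-dec (Product.≡-dec Fin._≟_ _≟L_)
                          (Product.≡-dec (λ o o' → yes (T-irrelevant o o')) Fin._≟_)))))

  _≟V_ : DecidableEquality Vtx
  u ≟V v = map′ (λ e → trans (sym (decode-encode u)) (trans (cong decode e) (decode-encode v)))
                (cong encode) (encode u ≟C encode v)

  search-Literal : Searchable (Literal n)
  search-Literal = search-Σ search-Fin (λ _ → search-Bool)

  search-Vtx : Searchable Vtx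
  search-Vtx = search-onto decode encode decode-encode
    (search-⊎ search-Literal (search-⊎ search-Fin (search-⊎ search-Fin (search-⊎ search-Fin
      (search-Σ (search-Σ search-Fin (λ _ → search-Literal))
                (λ (j , l) → search-Σ (search-T (occurs l (φ j))) (λ _ → search-Fin)))))))

  edge? : ∀ u v → Dec (Edge u v)
  edge? (X i b) (X i' b') with toℕ i' ≟ suc (toℕ i) | i Fin.≟ i'
  ... | yes e | _ = yes (ladder i i' b b' e)
  ... | no ne | no ni = no λ { (xx _) → ni refl ; (ladder _ _ _ _ e) → ne e }
  edge? (X i true)  (X .i false) | no ne | yes refl = yes (xx i)
  edge? (X i true)  (X .i true)  | no ne | yes refl = no λ { (ladder _ _ _ _ e) → ne e }
  edge? (X i false) (X .i b')    | no ne | yes refl = no λ { (ladder _ _ _ _ e) → ne e }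
  edge? (VL t) (VL t') with toℕ t' ≟ suc (toℕ t)
  ... | yes e = yes (vl t t' e)
  ... | no ne = no λ { (vl _ _ e) → ne e }
  edge? (VL t) (X i b) with suc (toℕ t) ≟ n | toℕ i ≟ 0
  ... | yes e₁ | yes e₂ = yes (vlx t i b e₁ e₂)
  ... | no ne  | _      = no λ { (vlx _ _ _ e₁ _) → ne e₁ }
  ... | _      | no ne  = no λ { (vlx _ _ _ _ e₂) → ne e₂ }
  edge? (VR t) (VR t') with toℕ t' ≟ suc (toℕ t)
  ... | yes e = yes (vr t t' e)
  ... | no ne = no λ { (vr _ _ e) → ne e }
  edge? (VR t) (X i b) with toℕ t ≟ 0 | suc (toℕ i) ≟ n
  ... | yes e₁ | yes e₂ = yes (vrx t i b e₁ e₂)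
  ... | no ne  | _      = no λ { (vrx _ _ _ e₁ _) → ne e₁ }
  ... | _      | no ne  = no λ { (vrx _ _ _ _ e₂) → ne e₂ }
  edge? (C j) (P j' l o t) with j Fin.≟ j' | toℕ t ≟ 0
  ... | no ne    | _     = no λ { (cp _ _ _ _ _) → ne refl }
  ... | yes refl | yes e = yes (cp j l o t e)
  ... | yes refl | no ne = no λ { (cp _ _ _ _ e) → ne e }
  edge? (P j l o t) (P j' l' o' t') with j Fin.≟ j' | l ≟L l' | toℕ t' ≟ suc (toℕ t)
  ... | no ne    | _        | _     = no λ { (pp _ _ _ _ _ _) → ne refl }
  ... | yes refl | no ne    | _     = no λ { (pp _ _ _ _ _ _) → ne refl }
  ... | yes refl | yes refl | no ne = no λ { (pp _ _ _ _ _ e) → ne e }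
  ... | yes refl | yes refl | yes e with T-irrelevant o o'
  ...   | refl = yes (pp j l o t t' e)
  edge? (P j (i , b) o t) (X i' b') with i Fin.≟ i' | b Bool.≟ b' | suc (toℕ t) ≟ h
  ... | no ne    | _        | _     = no λ { (px _ _ _ _ _) → ne refl }
  ... | yes refl | no ne    | _     = no λ { (px _ _ _ _ _) → ne refl }
  ... | yes refl | yes refl | no ne = no λ { (px _ _ _ _ e) → ne e }
  ... | yes refl | yes refl | yes e = yes (px j (i , b) o t e)
  edge? (X _ _)     (VL _)      = no λ ()
  edge? (X _ _)     (VR _)      = no λ ()
  edge? (X _ _)     (C _)       = no λ ()
  edge? (X _ _)     (P _ _ _ _) = no λ ()
  edge? (VL _)      (VR _)      = no λ ()
  edge? (VL _)      (C _)       = no λ ()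
  edge? (VL _)      (P _ _ _ _) = no λ ()
  edge? (VR _)      (VL _)      = no λ ()
  edge? (VR _)      (C _)       = no λ ()
  edge? (VR _)      (P _ _ _ _) = no λ ()
  edge? (C _)       (X _ _)     = no λ ()
  edge? (C _)       (VL _)      = no λ ()
  edge? (C _)       (VR _)      = no λ ()
  edge? (C _)       (C _)       = no λ ()
  edge? (P _ _ _ _) (VL _)      = no λ ()
  edge? (P _ _ _ _) (VR _)      = no λ ()
  edge? (P _ _ _ _) (C _)       = no λ ()

  adj? : ∀ u v → Dec (Adj u v)
  adj? u v = edge? u v ⊎-dec edge? v u

  open Decidable _≟V_ adj? search-Vtx

  -- The diameter bound: every vertex reaches the literal row within n steps,
  -- and the row has diameter n - 1, so all distances are at most D = 3n - 1.
  D : ℕ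
  D = n' + suc (n' + suc n')

  some-literal : (c : Clause n) → ∃[ l ] T (occurs l c)
  some-literal (l ∷ c) = l , occurs-complete (l ∷ c) (here refl)

  to-row : ∀ z → ∃[ i ] ∃[ b ] ∃[ L ] (Walk G z (X i b) L × L ≤ n)
  to-row (X i b)     = i , b , 0 , nil , z≤n
  to-row (VL t)      = first , true , _ ,
                       snoc (LeftPath.along t last (n' ∸ toℕ t) (trans toℕ-last (sym (m+[n∸m]≡n (index≤ t)))))
                            (inj₁ (vlx last first true (cong suc toℕ-last) refl)) ,
                       s≤s (m∸n≤m n' (toℕ t))
  to-row (VR t)      = last , true , _ ,
                       snoc (reverse (RightPath.along first t (toℕ t) refl))
                            (inj₁ (vrx first last true refl (cong suc toℕ-last))) ,
                       toℕ<n t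
  to-row (C j)       = let (l , o) = some-literal (φ j) in
                       _ , _ , _ , Gadget.clause-to-literal j l o , h<n
  to-row (P j l o t) = _ , _ , _ , Gadget.to-literal j l o t ,
                       ≤-trans (Gadget.to-literal-length j l o t) (<⇒≤ h<n)

  climb : ∀ (i i' : Fin n) b b' → toℕ i < toℕ i' → ∃[ L ] (Walk G (X i b) (X i' b') L × L ≤ n')
  climb i i' b b' lt = suc d , ladder-walk i i' d b b' e ,
                        ≤-trans (≤-trans (m≤n+m (suc d) (toℕ i)) (≤-reflexive (sym e))) (index≤ i')
    where
      d : ℕ
      d = toℕ i' ∸ suc (toℕ i)
      e : toℕ i' ≡ toℕ i + suc d
      e = sym (trans (+-suc (toℕ i) d) (m+[n∸m]≡n lt))

  within-row : ∀ i b i' b' → ∃[ L ] (Walk G (X i b) (X i' b') L × L ≤ n')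
  within-row i b i' b' with <-cmp (toℕ i) (toℕ i')
  ... | tri< lt _ _ = climb i i' b b' lt
  ... | tri> _ _ gt = let (L , w , le) = climb i' i b' b gt in L , reverse w , le
  ... | tri≈ _ eq _ with toℕ-injective eq | b Bool.≟ b'
  ...   | refl | yes refl = 0 , nil , z≤n
  ...   | refl | no ne    = 1 , flip-walk i b b' ne , s≤s z≤n

  distance-bounded : ∀ x y → ∃[ d ] (Dist G x y d × d ≤ D)
  distance-bounded x y =
    let (i , b , L₁ , w₁ , le₁)   = to-row x
        (i' , b' , L₂ , w₂ , le₂) = to-row y
        (L₃ , w₃ , le₃)           = within-row i b i' b'
        (d , dist , d≤)           = shortest (w₁ ++w w₃ ++w reverse w₂)
    in d , dist , ≤-trans d≤ (≤-trans (+-mono-≤ le₁ (+-mono-≤ le₃ le₂))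
                                      (≤-reflexive (sym (+-suc n' (n' + suc n')))))

  ends-far : NoShorter (VL first) (VR last) D
  ends-far r w = ≤-trans (≤-reflexive (sym ends-apart)) (LeftPotential.walk-bound w)
    where
      ends-apart : LeftPotential.f (VR last) ≡ D
      ends-apart = trans (cong (n + n +_) toℕ-last) (+-comm (n + n) n')

  -- For an assignment a, the spine path
  --   V₁ … Vₙ X₁ᵃ⁽¹⁾ … Xₙᵃ⁽ⁿ⁾ Vₙ₊₁ … V₂ₙ
  -- has length D, so it is shortest, so it is diametral; if a
  -- satisfies φ, every vertex is within h + 1 of it.
  module SpinePath (a : Fin n → Bool) where

    left : Walk G (VL first) (VL last) n'
    left = LeftPath.along first last n' toℕ-last

    row : Walk G (X first (a first)) (X last (a last)) n'
    row = Row.along a first last n' toℕ-last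

    right : Walk G (VR first) (VR last) n'
    right = RightPath.along first last n' toℕ-last

    spine : Walk G (VL first) (VR last) D
    spine = left ++w cons (inj₁ (vlx last first (a first) (cong suc toℕ-last) refl))
                   (row ++w cons (inj₂ (vrx first last (a last) refl (cong suc toℕ-last))) right)

    between-ends : (t : Fin n) → toℕ t ≤ toℕ last
    between-ends t = ≤-trans (index≤ t) (≤-reflexive (sym toℕ-last))

    on-left : ∀ t → OnWalk G (VL t) spine
    on-left t = on-++ˡ left _ (LeftPath.on-along first last n' toℕ-last t z≤n (between-ends t))

    on-row : ∀ t → OnWalk G (X t (a t)) spine
    on-row t = on-++ʳ left _ (there _ _ (on-++ˡ row _
                 (Row.on-along a first last n' toℕ-last t z≤n (between-ends t))))

    on-right : ∀ t → OnWalk G (VR t) spine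
    on-right t = on-++ʳ left _ (there _ _ (on-++ʳ row _ (there _ _
                   (RightPath.on-along first last n' toℕ-last t z≤n (between-ends t)))))

    -- each vertex reaches the spine within h + 1 steps: literal vertices by at
    -- most one flip, gadget vertices through their literal, clause vertices
    -- through a literal made true by a
    module _ (satisfies : ∀ j → Any (λ l → a (proj₁ l) ≡ proj₂ l) (φ j)) where

      reach-spine : ∀ z → ∃[ y ] (OnWalk G y spine × ∃[ L ] (Walk G z y L × L ≤ h + 1))
      reach-spine (VL t) = VL t , on-left t , 0 , nil , z≤n
      reach-spine (VR t) = VR t , on-right t , 0 , nil , z≤n
      reach-spine (X i b) with b Bool.≟ a i
      ... | yes refl = X i b , on-row i , 0 , nil , z≤n
      ... | no ne    = X i (a i) , on-row i , 1 , flip-walk i b (a i) ne , m≤n+m 1 h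
      reach-spine (C j) with find (satisfies j)
      ... | (i , b) , mem , true-lit = X i (a i) , on-row i , _ ,
            subst (λ c → Walk G (C j) (X i c) (suc h)) (sym true-lit)
                  (Gadget.clause-to-literal j (i , b) (occurs-complete (φ j) mem)) ,
            ≤-reflexive (+-comm 1 h)
      reach-spine (P j (i , b) o t) with b Bool.≟ a i
      ... | yes refl = X i b , on-row i , _ , Gadget.to-literal j (i , b) o t ,
                       ≤-trans (Gadget.to-literal-length j (i , b) o t) (m≤m+n h 1)
      ... | no ne    = X i (a i) , on-row i , _ ,
                       Gadget.to-literal j (i , b) o t ++w flip-walk i b (a i) ne ,
                       +-monoˡ-≤ 1 (Gadget.to-literal-length j (i , b) o t)

      dominating : Dominating G (h + 1) spine
      dominating z = let (y , on , L , w , L≤) = reach-spine z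
                         (d , dist , d≤L)      = shortest w
                     in y , on , d , dist , ≤-trans d≤L L≤

      laminar : Laminar G (h + 1)
      laminar = D , (distance-bounded , VL first , VR last , spine , ends-far) ,
                VL first , VR last , spine , (spine , ends-far) , dominating

  -- Laminar ⇒ satisfiable.  The two vertices of variable i are seen at equal
  -- distance from the ends of the spine: from the left end when i > 0, from
  -- the right end when i = 0.
  Equidistant : Vtx → Fin n → Set
  Equidistant w i = ∃[ d ] (∀ b → Dist G w (X i b) d)

  h+1≤n : h + 1 ≤ n
  h+1≤n = ≤-trans (≤-reflexive (+-comm h 1)) h<n

  too-high : ∀ {a} → suc n ≤ a → ¬ (a ≤ h + 1)
  too-high n<a a≤ = 1+n≰n (≤-trans n<a (≤-trans a≤ h+1≤n))

  high-tail : ∀ t → suc n ≤ n + n + t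
  high-tail t = ≤-trans (s≤s (m≤n+m n n')) (m≤m+n (n + n) t)

  high-clause : suc n ≤ n + h
  high-clause = ≤-trans (≤-reflexive (+-comm 1 n)) (+-monoʳ-≤ n (s≤s z≤n))

  near-left-end : ∀ u → LeftPotential.f u ≤ h + 1 → (∃[ t ] u ≡ VL t) ⊎ (∃[ b ] u ≡ X first b)
  near-left-end (VL t) _ = inj₁ (t , refl)
  near-left-end (X i b) le with toℕ-injective {i = i} {j = first}
                                  (n≤0⇒n≡0 (+-cancelˡ-≤ n _ _ (≤-trans le (≤-trans h+1≤n (≤-reflexive (sym (+-identityʳ n)))))))
  ... | refl = inj₂ (b , refl)
  near-left-end (VR t)      le = ⊥-elim (too-high (high-tail (toℕ t)) le)
  near-left-end (C j)       le = ⊥-elim (too-high high-clause le)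
  near-left-end (P j l o t) le = ⊥-elim (too-high (LeftPotential.gadget-high j l o t) le)

  near-right-end : ∀ u → RightPotential.f u ≤ h + 1 → (∃[ t ] u ≡ VR t) ⊎ (∃[ b ] u ≡ X last b)
  near-right-end (VR t) _ = inj₁ (t , refl)
  near-right-end (X i b) le with toℕ-injective {i = i} {j = last} (trans i≡n' (sym toℕ-last))
    where
      i≡n' : toℕ i ≡ n'
      i≡n' = ≤-antisym (index≤ i) (m∸n≡0⇒m≤n (n≤0⇒n≡0 (+-cancelˡ-≤ n _ _
               (≤-trans le (≤-trans h+1≤n (≤-reflexive (sym (+-identityʳ n))))))))
  ... | refl = inj₂ (b , refl)
  near-right-end (VL t)      le = ⊥-elim (too-high (high-tail (n' ∸ toℕ t)) le)
  near-right-end (C j)       le = ⊥-elim (too-high high-clause le)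
  near-right-end (P j l o t) le = ⊥-elim (too-high (RightPotential.gadget-high j l o t) le)

  left-tail-equidistant : ∀ t i i' → toℕ i ≡ suc i' → Equidistant (VL t) i
  left-tail-equidistant t i i' e = _ , λ b → LeftPotential.tight
    (LeftPath.along t last (n' ∸ toℕ t) (trans toℕ-last (sym (m+[n∸m]≡n (index≤ t))))
      ++w cons (inj₁ (vlx last first true (cong suc toℕ-last) refl)) (ladder-walk first i i' true b e))
    (begin
      toℕ t + ((n' ∸ toℕ t) + suc (suc i'))  ≡⟨ sym (+-assoc (toℕ t) _ _) ⟩
      toℕ t + (n' ∸ toℕ t) + suc (suc i')    ≡⟨ cong (_+ suc (suc i')) (m+[n∸m]≡n (index≤ t)) ⟩
      n' + suc (suc i')                      ≡⟨ +-suc n' (suc i') ⟩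
      n + suc i'                             ≡⟨ cong (n +_) (sym e) ⟩
      n + toℕ i                              ∎)
    where open ≡-Reasoning

  first-rung-equidistant : ∀ b₀ i i' → toℕ i ≡ suc i' → Equidistant (X first b₀) i
  first-rung-equidistant b₀ i i' e = _ , λ b → LeftPotential.tight (ladder-walk first i i' b₀ b e)
    (trans (cong (_+ suc i') (+-identityʳ n)) (cong (n +_) (sym e)))

  right-tail-equidistant : ∀ t i → toℕ i ≡ 0 → Equidistant (VR t) i
  right-tail-equidistant t i e = _ , λ b → RightPotential.tight
    (reverse (RightPath.along first t (toℕ t) refl)
      ++w cons (inj₁ (vrx first last true refl (cong suc toℕ-last)))
               (reverse (ladder-walk i last k b true (trans toℕ-last (cong (_+ n') (sym e))))))
    (begin
      (n' ∸ toℕ t) + (toℕ t + suc n')   ≡⟨ sym (+-assoc (n' ∸ toℕ t) _ _) ⟩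
      (n' ∸ toℕ t) + toℕ t + suc n'     ≡⟨ cong (_+ suc n') (m∸n+n≡m (index≤ t)) ⟩
      n' + suc n'                       ≡⟨ +-suc n' n' ⟩
      n + n'                            ≡⟨ cong (λ z → n + (n' ∸ z)) (sym e) ⟩
      n + (n' ∸ toℕ i)                  ∎)
    where open ≡-Reasoning

  last-rung-equidistant : ∀ b₀ i → toℕ i ≡ 0 → Equidistant (X last b₀) i
  last-rung-equidistant b₀ i e = _ , λ b → RightPotential.tight
    (reverse (ladder-walk i last k b b₀ (trans toℕ-last (cong (_+ n') (sym e)))))
    (begin
      n + (n' ∸ toℕ last) + n'   ≡⟨ cong (λ z → n + (n' ∸ z) + n') toℕ-last ⟩
      n + (n' ∸ n') + n'         ≡⟨ cong (λ z → n + z + n') (n∸n≡0 n') ⟩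
      n + 0 + n'                 ≡⟨ cong (_+ n') (+-identityʳ n) ⟩
      n + n'                     ≡⟨ cong (λ z → n + (n' ∸ z)) (sym e) ⟩
      n + (n' ∸ toℕ i)           ∎)
    where open ≡-Reasoning

  -- a walk leaving both ends within reach of one clause vertex is shorter than D
  short-detour : suc h + suc h < D
  short-detour = begin-strict
    suc h + suc h          ≡⟨ +-suc (suc h) h ⟩
    suc (suc (h + h))      ≡⟨ cong (λ z → suc (suc z)) (sym n≡h+h) ⟩
    2 + n                  <⟨ +-monoˡ-≤ n three≤ ⟩
    n' + n + n             ≡⟨ +-assoc n' n n ⟩
    D                      ∎
    where
      open ≤-Reasoning
      three≤ : 3 ≤ n' + n
      three≤ = s≤s (≤-trans (s≤s (s≤s z≤n)) (m≤n+m (suc (suc k)) k))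

  module DiametralPath {Dd x y} (p : Walk G x y Dd) (p-short : NoShorter x y Dd)
                       (long : D ≤ Dd) (dom : Dominating G (h + 1) p) where
    open Geodesic p p-short

    equidistant-witness : ∀ i → ∃[ w ] (OnWalk G w p × Equidistant w i)
    equidistant-witness i with toℕ i in i≡
    ... | suc i' with dom (VL first)
    ...   | u , on , d , (w , _) , d≤ with near-left-end u (≤-trans (LeftPotential.walk-bound w) d≤)
    ...     | inj₁ (t , refl) = u , on , left-tail-equidistant t i i' i≡
    ...     | inj₂ (b , refl) = u , on , first-rung-equidistant b i i' i≡
    equidistant-witness i | zero with dom (VR last)
    ...   | v , on , d , (w , _) , d≤ with near-right-end v right-bound
      where
        right-bound : RightPotential.f v ≤ h + 1
        right-bound = ≤-trans (RightPotential.walk-bound w)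
                              (≤-trans (≤-reflexive (cong (λ z → n' ∸ z + d) toℕ-last))
                                       (≤-trans (≤-reflexive (cong (_+ d) (n∸n≡0 n'))) d≤))
    ...     | inj₁ (t , refl) = v , on , right-tail-equidistant t i i≡
    ...     | inj₂ (b , refl) = v , on , last-rung-equidistant b i i≡

    -- p never contains both vertices of a variable: they are adjacent, and the
    -- equidistant witness on p would violate parity along the geodesic
    consistent : ∀ i → OnWalk G (X i true) p → OnWalk G (X i false) p → ⊥
    consistent i on-true on-false =
      let (w , on-w , d , equi) = equidistant-witness i
          (ka , dist-a) = position on-true
          (kb , dist-b) = position on-false
          (kw , dist-w) = position on-w
      in not-equidistant kw ka kb
           (position-gap on-true on-false dist-a dist-b rung)
           (trans (position-gap on-w on-true dist-w dist-a (equi true))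
                  (sym (position-gap on-w on-false dist-w dist-b (equi false))))
      where
        rung : Dist G (X i true) (X i false) 1
        rung = cons (inj₁ (xx i)) nil , λ { r (cons _ _) → s≤s z≤n }

    -- every clause C_j has one of its literal vertices on p: the vertex of p
    -- dominating C_j has clause potential at most h + 1, an end of p has more
    -- (else p would be shorter than D), so p crosses the level h + 1
    clause-hit : ∀ j → ∃[ i ] ∃[ b ] (T (occurs (i , b) (φ j)) × OnWalk G (X i b) p)
    clause-hit j with dom (C j)
    ... | y₀ , on-y₀ , d , (w , _) , d≤ = hit crossing
      where
        open ClausePotential j
        module S = Split (split p on-y₀)

        y₀-close : ψ y₀ ≤ suc h
        y₀-close = ≤-trans (walk-bound w)
                     (≤-trans (≤-reflexive (cong (_+ d) ψ-clause)) (≤-trans d≤ (≤-reflexive (+-comm h 1))))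

        ends-not-both-close : ψ x ≤ suc h → ψ y ≤ suc h → ⊥
        ends-not-both-close x-close y-close =
          let (L₁ , w₁ , L₁≤) = reach-clause x x-close
              (L₂ , w₂ , L₂≤) = reach-clause y y-close
          in <⇒≱ short-detour (≤-trans long (≤-trans (p-short _ (w₁ ++w reverse w₂)) (+-mono-≤ L₁≤ L₂≤)))

        crossing : ∃[ z ] (OnWalk G z p × ψ z ≡ suc h)
        crossing with ψ x ≤? suc h | ψ y ≤? suc h
        ... | yes x-close | yes y-close = ⊥-elim (ends-not-both-close x-close y-close)
        ... | no x-far | _ =
          let (z , on , e) = intermediate S.prefix (suc h) (inj₂ (y₀-close , <⇒≤ (≰⇒> x-far)))
          in z , S.on-prefix on , e
        ... | yes _ | no y-far =
          let (z , on , e) = intermediate S.suffix (suc h) (inj₁ (y₀-close , <⇒≤ (≰⇒> y-far)))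
          in z , S.on-suffix on , e

        hit : ∃[ z ] (OnWalk G z p × ψ z ≡ suc h) → ∃[ i ] ∃[ b ] (T (occurs (i , b) (φ j)) × OnWalk G (X i b) p)
        hit (z , on , e) with level-literal z e
        ... | i , b , refl , occ = i , b , occ , on

    assignment : Fin n → Bool
    assignment i = does (on? (X i true) p)

    assignment-agrees : ∀ i b → OnWalk G (X i b) p → assignment i ≡ b
    assignment-agrees i b on with on? (X i true) p | b
    ... | yes _       | true  = refl
    ... | no  off     | true  = ⊥-elim (off on)
    ... | yes on-true | false = ⊥-elim (consistent i on-true on)
    ... | no  _       | false = refl

    satisfied : Satisfiable φ
    satisfied = assignment , λ j →
      let (i , b , occ , on) = clause-hit j
      in Any.map (λ { refl → assignment-agrees i b on }) (occurs-sound (φ j) occ)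

  satisfiable : Laminar G (h + 1) → Satisfiable φ
  satisfiable (Dd , (bounded , _) , x , y , p , (_ , p-short) , dom) =
    DiametralPath.satisfied p p-short long dom
    where
      long : D ≤ Dd
      long = let (d , (w , _) , d≤) = bounded (VL first) (VR last) in ≤-trans (ends-far _ w) d≤

even-halves : ∀ N → 2 ∣ N → N ≡ ⌊ N /2⌋ + ⌊ N /2⌋
even-halves _ (divides q refl) = trans double (sym (cong₂ _+_ half half))
  where
    double : q * 2 ≡ q + q
    double = trans (*-comm q 2) (cong (q +_) (+-identityʳ q))
    half : ⌊ q * 2 /2⌋ ≡ q
    half = trans (cong ⌊_/2⌋ double) (sym (n≡⌊n+n/2⌋ q))

theorem4 : (n m : ℕ) (φ : CNF3 n m) → 2 ∣ n → 0 < n →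
    Laminar (Construction.G φ) (⌊ n /2⌋ + 1) ⇔ Satisfiable φ
theorem4 (suc (suc k)) m φ two∣n _ =
  mk⇔ (Reduction.satisfiable k m φ n≡h+h)
      (λ (a , satisfies) → Reduction.SpinePath.laminar k m φ n≡h+h a satisfies)
  where
    n≡h+h : suc (suc k) ≡ ⌊ suc (suc k) /2⌋ + ⌊ suc (suc k) /2⌋
    n≡h+h = even-halves (suc (suc k)) two∣n
theorem4 zero       _ _ _ ()
theorem4 (suc zero) _ _ (divides (suc q) ()) _
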